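{- Let $n,k$ be integers with $k\ge1$, $n>2k$, and $n$ odd. Then $\beta(P(n,k))\ge n+\frac{\gcd(n,k)+1}{2}$.
   Context: $P(n,k)$ is the generalized Petersen graph with vertices $u_1,\dots,u_n,v_1,\dots,v_n$ and edges $u_iu_{i+1}$, $u_iv_i$, $v_iv_{i+k}$ (subscripts modulo $n$). $\beta(G)$ denotes the size of a minimum vertex cover of $G$. -}

module Defs where

open import Data.Nat using (ℕ; suc; _+_; NonZero)
open import Data.Nat.DivMod using (_%_; m%n<n)
open import Data.Fin using (Fin; toℕ; fromℕ<)
open import Data.Bool using (Bool; true; false; T; _∨_)
open import Data.List using (List; map; _++_; filter; length; allFin)
open import Data.Sum using (_⊎_)
open import Data.Product using (_×_)
open import Relation.Nullary.Decidable using (does)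
open import Data.Bool.Properties using (T?)

data Vtx (n : ℕ) : Set where
  u : Fin n → Vtx n
  v : Fin n → Vtx n

_⊕_ : {n : ℕ} → Fin n → ℕ → Fin n
_⊕_ {suc m} i j = fromℕ< (m%n<n (toℕ i + j) (suc m))

data Edge (n k : ℕ) : Vtx n → Vtx n → Set where
  outer : (i : Fin n) → Edge n k (u i) (u (i ⊕ 1))
  spoke : (i : Fin n) → Edge n k (u i) (v i)
  inner : (i : Fin n) → Edge n k (v i) (v (i ⊕ k))

VSet : ℕ → Set
VSet n = Vtx n → Bool

IsVertexCover : (n k : ℕ) → VSet n → Set
IsVertexCover n k C = ∀ {x y} → Edge n k x y → T (C x) ⊎ T (C y)

allVtx : (n : ℕ) → List (Vtx n)
allVtx n = map u (allFin n) ++ map v (allFin n)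

card : {n : ℕ} → VSet n → ℕ
card {n} C = length (filter (λ x → T? (C x)) (allVtx n))

module Submission where

-- Both the outer rim and the inner part of P(n,k) are "circulant covers": a
-- periodic 0/1 labelling g of ℤ_N such that every step i ↦ i + s has a labelled
-- end.  Double counting the N steps gives  N + #(steps with both ends labelled)
-- ≤ 2·|g|.  If N = m·d with m odd and d ∣ s, the steps split into d closed walks
-- of odd length m (one per residue mod d), and on an odd closed walk the labels
-- cannot alternate, so each walk contains a doubly labelled step.  Hence
-- N + d ≤ 2·|g| (circulant-cover-bound).  Applied to the rim (s = 1, d = 1) and to
-- the inner vertices (s = k, d = gcd n k) and added up, this is the theorem.

open import Defs
open import Data.Nat using (ℕ; _+_; _*_; _≤_; _<_)
open import Data.Nat.GCD using (gcd)
open import Data.Nat.Divisibility using (_∤_)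

open import Data.Nat using (zero; suc; NonZero; ≢-nonZero; z≤n; s≤s; _/_; _%_)
open import Data.Nat.Properties
open import Data.Nat.DivMod
open import Data.Nat.Divisibility using (_∣_; divides; ∣-refl; ∣m+n∣m⇒∣n; ∣m∣n⇒∣m+n; ∣m⇒∣m*n)
open import Data.Nat.GCD using (gcd[m,n]∣m; gcd[m,n]∣n; gcd[m,n]≢0)
open import Data.Nat.Solver using (module +-*-Solver)
open import Algebra.Properties.CommutativeSemigroup +-commutativeSemigroup using (interchange)
open import Data.Fin using (Fin; toℕ; fromℕ<) renaming (zero to fzero; suc to fsuc)
open import Data.Fin.Properties using (toℕ-injective; toℕ-fromℕ<; toℕ<n)
open import Data.Bool using (Bool; true; false; T; _∧_)
open import Data.Bool.Properties using (T?)
open import Data.List using (List; []; _∷_; map; _++_; filter; length; allFin; tabulate)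
open import Data.List.Properties using (map-++; map-tabulate; map-∘)
open import Data.Nat.ListAction using (sum)
open import Data.Nat.ListAction.Properties using (sum-++)
open import Data.Sum using (_⊎_; inj₁; inj₂)
open import Data.Product using (_×_; _,_; ∃-syntax)
open import Data.Empty using (⊥-elim)
open import Data.Unit using (tt)
open import Relation.Binary.PropositionalEquality
open import Function using (_∘_)

𝟙 : Bool → ℕ
𝟙 true  = 1
𝟙 false = 0

𝟙-true : ∀ {x} → T x → 𝟙 x ≡ 1
𝟙-true {true} _ = refl

∑ : ℕ → (ℕ → ℕ) → ℕ
∑ zero    f = 0
∑ (suc n) f = f 0 + ∑ n (f ∘ suc)

∑-cong : ∀ n {f g : ℕ → ℕ} → (∀ i → f i ≡ g i) → ∑ n f ≡ ∑ n g
∑-cong zero    eq = refl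
∑-cong (suc n) eq = cong₂ _+_ (eq 0) (∑-cong n (eq ∘ suc))

∑-mono : ∀ n {f g : ℕ → ℕ} → (∀ i → i < n → f i ≤ g i) → ∑ n f ≤ ∑ n g
∑-mono zero    le = z≤n
∑-mono (suc n) le = +-mono-≤ (le 0 (s≤s z≤n)) (∑-mono n (λ i i<n → le (suc i) (s≤s i<n)))

∑-+ : ∀ n (f g : ℕ → ℕ) → ∑ n (λ i → f i + g i) ≡ ∑ n f + ∑ n g
∑-+ zero    f g = refl
∑-+ (suc n) f g =
  trans (cong (f 0 + g 0 +_) (∑-+ n (f ∘ suc) (g ∘ suc)))
        (interchange (f 0) (g 0) (∑ n (f ∘ suc)) (∑ n (g ∘ suc)))

∑-const : ∀ n c → ∑ n (λ _ → c) ≡ n * c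
∑-const zero    c = refl
∑-const (suc n) c = cong (c +_) (∑-const n c)

∑-split : ∀ a b (f : ℕ → ℕ) → ∑ (a + b) f ≡ ∑ a f + ∑ b (λ i → f (a + i))
∑-split zero    b f = refl
∑-split (suc a) b f = trans (cong (f 0 +_) (∑-split a b (f ∘ suc))) (sym (+-assoc (f 0) _ _))

∑-term : ∀ n (f : ℕ → ℕ) {j} → j < n → f j ≤ ∑ n f
∑-term (suc n) f {zero}  _         = m≤m+n (f 0) _
∑-term (suc n) f {suc j} (s≤s j<n) = ≤-trans (∑-term n (f ∘ suc) j<n) (m≤n+m _ (f 0))

∑-last : ∀ n (f : ℕ → ℕ) → ∑ (suc n) f ≡ ∑ n f + f n
∑-last n f = begin
  ∑ (suc n) f                        ≡⟨ cong (λ x → ∑ x f) (+-comm 1 n) ⟩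
  ∑ (n + 1) f                        ≡⟨ ∑-split n 1 f ⟩
  ∑ n f + (f (n + 0) + 0)            ≡⟨ cong (∑ n f +_) (+-identityʳ _) ⟩
  ∑ n f + f (n + 0)                  ≡⟨ cong (λ x → ∑ n f + f x) (+-identityʳ n) ⟩
  ∑ n f + f n                        ∎
  where open ≡-Reasoning

∑-rotate₁ : ∀ n (f : ℕ → ℕ) → f n ≡ f 0 → ∑ n (f ∘ suc) ≡ ∑ n f
∑-rotate₁ n f fn≡f0 = +-cancelˡ-≡ (f 0) _ _ (begin
  f 0 + ∑ n (f ∘ suc)   ≡⟨ ∑-last n f ⟩
  ∑ n f + f n           ≡⟨ cong (∑ n f +_) fn≡f0 ⟩
  ∑ n f + f 0           ≡⟨ +-comm (∑ n f) (f 0) ⟩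
  f 0 + ∑ n f           ∎)
  where open ≡-Reasoning

∑-rotate : ∀ n k (f : ℕ → ℕ) → (∀ i → f (i + n) ≡ f i) → ∑ n (λ i → f (i + k)) ≡ ∑ n f
∑-rotate n zero    f per = ∑-cong n (λ i → cong f (+-identityʳ i))
∑-rotate n (suc k) f per = begin
  ∑ n (λ i → f (i + suc k))   ≡⟨ ∑-cong n (λ i → cong f (+-suc i k)) ⟩
  ∑ n (λ i → f (suc i + k))   ≡⟨ ∑-rotate₁ n (λ i → f (i + k)) (trans (cong f (+-comm n k)) (per k)) ⟩
  ∑ n (λ i → f (i + k))       ≡⟨ ∑-rotate n k f per ⟩
  ∑ n f                       ∎
  where open ≡-Reasoning

∑-residues : ∀ m d (f : ℕ → ℕ) → ∑ (m * d) f ≡ ∑ d (λ r → ∑ m (λ q → f (q * d + r)))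
∑-residues zero    d f = sym (trans (∑-const d 0) (*-zeroʳ d))
∑-residues (suc m) d f = begin
  ∑ (d + m * d) f
    ≡⟨ ∑-split d (m * d) f ⟩
  ∑ d f + ∑ (m * d) (λ i → f (d + i))
    ≡⟨ cong (∑ d f +_) (∑-residues m d (λ i → f (d + i))) ⟩
  ∑ d f + ∑ d (λ r → ∑ m (λ q → f (d + (q * d + r))))
    ≡⟨ cong (∑ d f +_) (∑-cong d (λ r → ∑-cong m (λ q → cong f (sym (+-assoc d (q * d) r))))) ⟩
  ∑ d f + ∑ d (λ r → ∑ m (λ q → f (d + q * d + r)))
    ≡⟨ sym (∑-+ d f _) ⟩
  ∑ d (λ r → ∑ (suc m) (λ q → f (q * d + r)))
    ∎
  where open ≡-Reasoning

-- Functions on ℤ_N, presented as functions on ℕ that respect congruence mod N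

Periodic : {A : Set} (N : ℕ) .{{_ : NonZero N}} → (ℕ → A) → Set
Periodic N g = ∀ i j → i % N ≡ j % N → g i ≡ g j

module _ {A : Set} {N : ℕ} .{{_ : NonZero N}} {g : ℕ → A} (per : Periodic N g) where

  periodic-+N : ∀ i → g (i + N) ≡ g i
  periodic-+N i = per (i + N) i ([m+n]%n≡m%n i N)

  periodic-% : ∀ i → g (i % N) ≡ g i
  periodic-% i = per (i % N) i (m%n%n≡m%n i N)

  periodic-shift : ∀ s → Periodic N (λ i → g (i + s))
  periodic-shift s i j i≡j = per (i + s) (j + s) (begin
    (i + s) % N               ≡⟨ %-distribˡ-+ i s N ⟩
    (i % N + s % N) % N       ≡⟨ cong (λ x → (x + s % N) % N) i≡j ⟩
    (j % N + s % N) % N       ≡⟨ %-distribˡ-+ j s N ⟨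
    (j + s) % N               ∎)
    where open ≡-Reasoning

CoversSteps : (ℕ → Bool) → ℕ → Set
CoversSteps g s = ∀ i → T (g i) ⊎ T (g (i + s))

doubly : (ℕ → Bool) → ℕ → ℕ → ℕ
doubly g s i = 𝟙 (g i ∧ g (i + s))

covered-step : ∀ a b → T a ⊎ T b → 1 + 𝟙 (a ∧ b) ≤ 𝟙 a + 𝟙 b
covered-step true  true  _        = ≤-refl
covered-step true  false _        = ≤-refl
covered-step false true  _        = ≤-refl
covered-step false false (inj₁ ())
covered-step false false (inj₂ ())

-- Double counting over one period: each of the N steps contributes its two
-- ends, and every label is counted once as a start and once as an end.
double-count : ∀ N (g : ℕ → Bool) s → (∀ i → g (i + N) ≡ g i) → CoversSteps g s →
  N + ∑ N (doubly g s) ≤ 2 * ∑ N (𝟙 ∘ g)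
double-count N g s per cover = begin
  N + ∑ N (doubly g s)
    ≡⟨ cong (_+ ∑ N (doubly g s)) (trans (sym (*-identityʳ N)) (sym (∑-const N 1))) ⟩
  ∑ N (λ _ → 1) + ∑ N (doubly g s)
    ≡⟨ ∑-+ N (λ _ → 1) (doubly g s) ⟨
  ∑ N (λ i → 1 + doubly g s i)
    ≤⟨ ∑-mono N (λ i _ → covered-step (g i) (g (i + s)) (cover i)) ⟩
  ∑ N (λ i → 𝟙 (g i) + 𝟙 (g (i + s)))
    ≡⟨ ∑-+ N (𝟙 ∘ g) (λ i → 𝟙 (g (i + s))) ⟩
  ∑ N (𝟙 ∘ g) + ∑ N (λ i → 𝟙 (g (i + s)))
    ≡⟨ cong (∑ N (𝟙 ∘ g) +_) (∑-rotate N s (𝟙 ∘ g) (cong 𝟙 ∘ per)) ⟩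
  ∑ N (𝟙 ∘ g) + ∑ N (𝟙 ∘ g)
    ≡⟨ cong (∑ N (𝟙 ∘ g) +_) (+-identityʳ _) ⟨
  2 * ∑ N (𝟙 ∘ g)
    ∎
  where open ≤-Reasoning

-- Along a walk b 0, b 1, … in which every step has a labelled end, either some
-- step before J is doubly labelled, or the labels alternate up to J, so that
-- [b J] + J + [b 0] is even.
walk-alternates : (b : ℕ → Bool) → (∀ J → T (b J) ⊎ T (b (suc J))) → ∀ J →
  (∃[ j ] j < J × T (b j ∧ b (suc j))) ⊎ 2 ∣ 𝟙 (b J) + J + 𝟙 (b 0)
walk-alternates b step zero with b 0
... | true  = inj₂ (divides 1 refl)
... | false = inj₂ (divides 0 refl)
walk-alternates b step (suc J) with walk-alternates b step J
... | inj₁ (j , j<J , both) = inj₁ (j , m<n⇒m<1+n j<J , both)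
... | inj₂ even with b J in bJ | b (suc J) in bJ+1 | step J
...   | true  | true  | _      = inj₁ (J , ≤-refl , subst₂ (λ x y → T (x ∧ y)) (sym bJ) (sym bJ+1) tt)
...   | true  | false | _      = inj₂ even
...   | false | true  | _      = inj₂ (∣m∣n⇒∣m+n (∣-refl {2}) even)
...   | false | false | inj₁ ()
...   | false | false | inj₂ ()

even-around : ∀ x m → 2 ∣ 𝟙 x + m + 𝟙 x → 2 ∣ m
even-around false m even = subst (2 ∣_) (+-identityʳ m) even
even-around true  m even = ∣m+n∣m⇒∣n (subst (2 ∣_) (cong suc (+-comm m 1)) even) (∣-refl {2})

-- A closed walk of odd length, every step of which has a labelled end, has a
-- step with both ends labelled (labels cannot alternate around an odd cycle).
odd-closed-walk : ∀ m (b : ℕ → Bool) → (∀ J → T (b J) ⊎ T (b (suc J))) →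
  b m ≡ b 0 → 2 ∤ m → ∃[ j ] j < m × T (b j ∧ b (suc j))
odd-closed-walk m b step closed odd with walk-alternates b step m
... | inj₁ doubled = doubled
... | inj₂ even    = ⊥-elim (odd (even-around (b 0) m (subst (λ x → 2 ∣ 𝟙 x + m + 𝟙 (b 0)) closed even)))

residue-class : ∀ {N d m s} .{{_ : NonZero N}} .{{_ : NonZero d}} → N ≡ m * d → d ∣ s →
  ∀ {r} → r < d → ∀ j → ∃[ q ] q < m × q * d + r ≡ (r + j * s) % N
residue-class {N} {d} {m} {s} N≡md (divides k′ s≡k′d) {r} r<d j =
  i / d , q<m , decomposition
  where
  i : ℕ
  i = (r + j * s) % N
  remainder : i % d ≡ r
  remainder = begin
    i % d                   ≡⟨ m∣n⇒o%n%m≡o%m d N (r + j * s) (divides m N≡md) ⟩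
    (r + j * s) % d         ≡⟨ cong (λ x → (r + x) % d) (trans (cong (j *_) s≡k′d) (sym (*-assoc j k′ d))) ⟩
    (r + j * k′ * d) % d    ≡⟨ [m+kn]%n≡m%n r (j * k′) d ⟩
    r % d                   ≡⟨ m<n⇒m%n≡m r<d ⟩
    r                       ∎
    where open ≡-Reasoning
  q<m : i / d < m
  q<m = m<n*o⇒m/o<n (subst (i <_) N≡md (m%n<n (r + j * s) N))
  decomposition : i / d * d + r ≡ i
  decomposition = begin
    i / d * d + r           ≡⟨ cong (i / d * d +_) remainder ⟨
    i / d * d + i % d       ≡⟨ +-comm (i / d * d) (i % d) ⟩
    i % d + i / d * d       ≡⟨ m≡m%n+[m/n]*n i d ⟨
    i                       ∎
    where open ≡-Reasoning

module _ {N d m s : ℕ} .{{_ : NonZero N}} .{{_ : NonZero d}}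
         {g : ℕ → Bool} (per : Periodic N g) (cover : CoversSteps g s)
         (N≡md : N ≡ m * d) (d∣s : d ∣ s) (odd : 2 ∤ m) where

  walk : ℕ → ℕ → Bool
  walk r J = g (r + J * s)

  walk-index : ∀ r J → r + J * s + s ≡ r + suc J * s
  walk-index r J = trans (+-assoc r (J * s) s) (cong (r +_) (+-comm (J * s) s))

  walk-step : ∀ r J → T (walk r J) ⊎ T (walk r (suc J))
  walk-step r J = subst (λ x → T (walk r J) ⊎ T (g x)) (walk-index r J) (cover (r + J * s))

  -- After m steps the walk is back: m·s is a multiple of N.
  walk-closed : ∀ r → walk r m ≡ walk r 0
  walk-closed r = per (r + m * s) (r + 0) (begin
    (r + m * s) % N    ≡⟨ cong (λ x → (r + x) % N) ms≡k′N ⟩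
    (r + k′ * N) % N   ≡⟨ [m+kn]%n≡m%n r k′ N ⟩
    r % N              ≡⟨ cong (_% N) (+-identityʳ r) ⟨
    (r + 0) % N        ∎)
    where
    open ≡-Reasoning
    open +-*-Solver
    open _∣_ d∣s renaming (quotient to k′; equality to s≡k′d)
    ms≡k′N : m * s ≡ k′ * N
    ms≡k′N rewrite s≡k′d | N≡md = solve 3 (λ m k′ d → m :* (k′ :* d) := k′ :* (m :* d)) refl m k′ d

  class-doubled : ∀ r → r < d → 1 ≤ ∑ m (λ q → doubly g s (q * d + r))
  class-doubled r r<d with odd-closed-walk m (walk r) (walk-step r) (walk-closed r) odd
  ... | j , j<m , both with residue-class N≡md d∣s r<d j
  ...   | q , q<m , q*d+r≡i = ≤-trans (≤-reflexive (sym doubled-at-q)) (∑-term m _ q<m)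
    where
    doubly-per : Periodic N (doubly g s)
    doubly-per i i′ i≡i′ = cong₂ (λ x y → 𝟙 (x ∧ y)) (per i i′ i≡i′) (periodic-shift per s i i′ i≡i′)
    doubled-at-j : doubly g s (r + j * s) ≡ 1
    doubled-at-j = 𝟙-true (subst (λ x → T (walk r j ∧ g x)) (sym (walk-index r j)) both)
    doubled-at-q : doubly g s (q * d + r) ≡ 1
    doubled-at-q = trans (cong (doubly g s) q*d+r≡i) (trans (periodic-% doubly-per (r + j * s)) doubled-at-j)

  -- At least d of the N steps are doubly labelled: one per residue class mod d.
  doubled-steps : d ≤ ∑ N (doubly g s)
  doubled-steps = begin
    d                                             ≡⟨ trans (sym (*-identityʳ d)) (sym (∑-const d 1)) ⟩
    ∑ d (λ _ → 1)                                 ≤⟨ ∑-mono d class-doubled ⟩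
    ∑ d (λ r → ∑ m (λ q → doubly g s (q * d + r))) ≡⟨ ∑-residues m d (doubly g s) ⟨
    ∑ (m * d) (doubly g s)                        ≡⟨ cong (λ x → ∑ x (doubly g s)) N≡md ⟨
    ∑ N (doubly g s)                              ∎
    where open ≤-Reasoning

  circulant-cover-bound : N + d ≤ 2 * ∑ N (𝟙 ∘ g)
  circulant-cover-bound = begin
    N + d                  ≤⟨ +-monoʳ-≤ N doubled-steps ⟩
    N + ∑ N (doubly g s)   ≤⟨ double-count N g s (periodic-+N per) cover ⟩
    2 * ∑ N (𝟙 ∘ g)        ∎
    where open ≤-Reasoning

count-filter : {A : Set} (P : A → Bool) (xs : List A) →
  length (filter (T? ∘ P) xs) ≡ sum (map (𝟙 ∘ P) xs)
count-filter P []       = refl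
count-filter P (x ∷ xs) with P x
... | true  = cong suc (count-filter P xs)
... | false = count-filter P xs

sum-tabulate : ∀ n (h : Fin n → ℕ) (f : ℕ → ℕ) → (∀ x → h x ≡ f (toℕ x)) →
  sum (tabulate h) ≡ ∑ n f
sum-tabulate zero    h f h≡f = refl
sum-tabulate (suc n) h f h≡f = cong₂ _+_ (h≡f fzero) (sum-tabulate n (h ∘ fsuc) (f ∘ suc) (h≡f ∘ fsuc))

module Petersen (n′ : ℕ) where

  N : ℕ
  N = suc n′

  ι : ℕ → Fin N
  ι i = fromℕ< (m%n<n i N)

  ι-periodic : Periodic N ι
  ι-periodic i j i≡j = toℕ-injective (trans (toℕ-fromℕ< _) (trans i≡j (sym (toℕ-fromℕ< _))))

  ι-toℕ : ∀ x → ι (toℕ x) ≡ x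
  ι-toℕ x = toℕ-injective (trans (toℕ-fromℕ< _) (m<n⇒m%n≡m (toℕ<n x)))

  ι-⊕ : ∀ i j → ι i ⊕ j ≡ ι (i + j)
  ι-⊕ i j = trans (cong (λ x → ι (x + j)) (toℕ-fromℕ< (m%n<n i N)))
                  (periodic-shift ι-periodic j (i % N) i (m%n%n≡m%n i N))

  labels : (w : Fin N → Vtx N) → VSet N → ℕ → Bool
  labels w C i = C (w (ι i))

  labels-periodic : ∀ w C → Periodic N (labels w C)
  labels-periodic w C i j i≡j = cong (C ∘ w) (ι-periodic i j i≡j)

  sum-allFin : (h : Fin N → ℕ) → sum (map h (allFin N)) ≡ ∑ N (h ∘ ι)
  sum-allFin h = trans (cong sum (map-tabulate (λ x → x) h))
                       (sum-tabulate N h (h ∘ ι) (λ x → cong h (sym (ι-toℕ x))))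

  card-split : (C : VSet N) → card C ≡ ∑ N (𝟙 ∘ labels u C) + ∑ N (𝟙 ∘ labels v C)
  card-split C = begin
    card C
      ≡⟨ count-filter C (allVtx N) ⟩
    sum (map (𝟙 ∘ C) (map u (allFin N) ++ map v (allFin N)))
      ≡⟨ cong sum (map-++ (𝟙 ∘ C) (map u (allFin N)) (map v (allFin N))) ⟩
    sum (map (𝟙 ∘ C) (map u (allFin N)) ++ map (𝟙 ∘ C) (map v (allFin N)))
      ≡⟨ sum-++ (map (𝟙 ∘ C) (map u (allFin N))) _ ⟩
    sum (map (𝟙 ∘ C) (map u (allFin N))) + sum (map (𝟙 ∘ C) (map v (allFin N)))
      ≡⟨ cong₂ _+_ (part u) (part v) ⟩
    ∑ N (𝟙 ∘ labels u C) + ∑ N (𝟙 ∘ labels v C)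
      ∎
    where
    open ≡-Reasoning
    part : (w : Fin N → Vtx N) → sum (map (𝟙 ∘ C) (map w (allFin N))) ≡ ∑ N (𝟙 ∘ labels w C)
    part w = trans (cong sum (sym (map-∘ (allFin N)))) (sum-allFin (𝟙 ∘ C ∘ w))

  outer-covers : ∀ {k} C → IsVertexCover N k C → CoversSteps (labels u C) 1
  outer-covers C cover i = subst (λ x → T (labels u C i) ⊎ T (C (u x))) (ι-⊕ i 1) (cover (outer (ι i)))

  inner-covers : ∀ {k} C → IsVertexCover N k C → CoversSteps (labels v C) k
  inner-covers {k} C cover i = subst (λ x → T (labels v C i) ⊎ T (C (v x))) (ι-⊕ i k) (cover (inner (ι i)))

proposition7 : (n k : ℕ) → 1 ≤ k → 2 * k < n → 2 ∤ n →
    (C : VSet n) → IsVertexCover n k C →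
    2 * n + (gcd n k + 1) ≤ 2 * card C
proposition7 zero      k _ () _ _ _
proposition7 N@(suc n′) k _ _ N-odd C cover = begin
  2 * N + (d + 1)       ≡⟨ solve 2 (λ N d → con 2 :* N :+ (d :+ con 1) := (N :+ con 1) :+ (N :+ d)) refl N d ⟩
  (N + 1) + (N + d)     ≤⟨ +-mono-≤ outer-bound inner-bound ⟩
  2 * a + 2 * b         ≡⟨ *-distribˡ-+ 2 a b ⟨
  2 * (a + b)           ≡⟨ cong (2 *_) (card-split C) ⟨
  2 * card C            ∎
  where
  open ≤-Reasoning
  open +-*-Solver
  open Petersen n′ hiding (N)
  d a b : ℕ
  d = gcd N k
  a = ∑ N (𝟙 ∘ labels u C)
  b = ∑ N (𝟙 ∘ labels v C)
  instance
    d≢0 : NonZero d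
    d≢0 = ≢-nonZero (gcd[m,n]≢0 N k (inj₁ (λ ())))
  open _∣_ (gcd[m,n]∣m N k) renaming (quotient to m; equality to N≡md)
  m-odd : 2 ∤ m
  m-odd 2∣m = N-odd (subst (2 ∣_) (sym N≡md) (∣m⇒∣m*n d 2∣m))
  outer-bound : N + 1 ≤ 2 * a
  outer-bound = circulant-cover-bound (labels-periodic u C) (outer-covers C cover)
                  (sym (*-identityʳ N)) ∣-refl N-odd
  inner-bound : N + d ≤ 2 * b
  inner-bound = circulant-cover-bound (labels-periodic v C) (inner-covers C cover)
                  N≡md (gcd[m,n]∣n N k) m-odd
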